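{- There exists an infinite family of strings $w$, with lengths $n=|w|$ unbounded over the family, such that $r(w^R)-r(w)=n/5$ for every $w$ in the family (in particular $r(w^R)-r(w)=\Theta(n)$).
   Context: Strings are over a finite totally ordered alphabet (which may depend on the string); strings are compared in the usual lexicographic order. For a string $w=w[1]\cdots w[n]$, its reverse is $w^R=w[n]\cdots w[1]$. A rotation of $w$ is a string $w[i\ldots n]w[1\ldots i-1]$ for $i\in[1,n]$. The Burrows–Wheeler transform ${\tt BWT}(w)$ is obtained by sorting the multiset of the $n$ rotations of $w$ lexicographically and concatenating the last characters of the sorted rotations. For a string $s$, the number of runs of $s$ is the number of maximal blocks of consecutive equal symbols (i.e., the length of its run-length encoding). $r(w)$ denotes the number of runs of ${\tt BWT}(w)$. -}

module Defs where

open import Data.Nat using (ℕ; zero; suc; _+_; _<ᵇ_; _≡ᵇ_)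
open import Data.Bool using (Bool; true; false; if_then_else_)
open import Data.List using (List; []; _∷_; _++_; drop; take; map; mapMaybe; last; length; upTo)

-- Strings over ℕ with its usual order (any finite totally ordered alphabet
-- embeds order-preservingly into ℕ; the alphabet of a string is the finite
-- set of symbols occurring in it).
Str : Set
Str = List ℕ

lexLeq : Str → Str → Bool
lexLeq [] _ = true
lexLeq (_ ∷ _) [] = false
lexLeq (a ∷ u) (b ∷ v) = if a <ᵇ b then true else (if a ≡ᵇ b then lexLeq u v else false)

insert : Str → List Str → List Str
insert x [] = x ∷ []
insert x (y ∷ ys) = if lexLeq x y then x ∷ y ∷ ys else y ∷ insert x ys

sortStrs : List Str → List Str
sortStrs [] = []
sortStrs (x ∷ xs) = insert x (sortStrs xs)

-- rotation w[i+1..n] w[1..i]  (0-based i ∈ [0, n-1])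
rotation : Str → ℕ → Str
rotation w i = drop i w ++ take i w

rotations : Str → List Str
rotations w = map (rotation w) (upTo (length w))

BWT : Str → Str
BWT w = mapMaybe last (sortStrs (rotations w))

runsFrom : ℕ → Str → ℕ
runsFrom _ [] = 0
runsFrom a (b ∷ s) = (if a ≡ᵇ b then 0 else 1) + runsFrom b s

runs : Str → ℕ
runs [] = 0
runs (a ∷ s) = suc (runsFrom a s)

r : Str → ℕ
r w = runs (BWT w)

{-# OPTIONS --safe #-}
-- Take w = B₀ B₁ ⋯ B_{k-1} with B_j = 0 2 2 2 1 shifted by 3j, so n = 5k. Every letter of B_j is
-- below every letter of a later block, hence the rotations of w are sorted first by the block in
-- which they start, and inside a block by the suffix of the block they start with (the five
-- suffixes pairwise differ before either ends). So BWT(w) is the concatenation of the block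
-- contributions c 2 2 2 0 (shifted, c the letter before the block): 3 runs per block. In w^R the
-- blocks 1 2 2 2 0 carry decreasing letters, so their contributions 2 c 2 2 1 are listed from the
-- last block to the first, and have 4 runs each. Thus r(w^R) - r(w) = k = n/5.
module Submission where

open import Defs
open import Data.Bool using (Bool; true; false; if_then_else_; T)
open import Data.Empty using (⊥; ⊥-elim)
open import Data.List
  using (List; []; _∷_; _++_; map; mapMaybe; last; length; reverse; applyUpTo; drop; take)
open import Data.List.Properties
  using (++-assoc; ++-identityʳ; ++-conicalʳ; reverse-++; map-applyUpTo; mapMaybe-++; mapMaybe-map)
open import Data.List.Relation.Unary.All as All using (All; []; _∷_; all?)
import Data.List.Relation.Unary.All.Properties as Allₚ
open import Data.List.Relation.Unary.AllPairs as AllPairs using (AllPairs; []; _∷_; allPairs?)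
import Data.List.Relation.Unary.AllPairs.Properties as AllPairsₚ
open import Data.Maybe using (Maybe; just)
open import Data.Nat using (ℕ; zero; suc; _+_; _*_; _≥_; _≤_; _<_; _<?_; _<ᵇ_; _≡ᵇ_)
open import Data.Nat.Properties
open import Data.Nat.Tactic.RingSolver using (solve-∀)
open import Data.Product using (Σ; _×_; _,_; proj₁; proj₂)
open import Data.Unit using (tt)
open import Function using (id; _∘_)
open import Relation.Binary.PropositionalEquality
open import Relation.Nullary.Decidable using (T?; from-yes)

open ≡-Reasoning

m+[n+o]≡n+[m+o] : ∀ m n o → m + (n + o) ≡ n + (m + o)
m+[n+o]≡n+[m+o] m n o = begin
  m + (n + o)  ≡⟨ sym (+-assoc m n o) ⟩
  m + n + o    ≡⟨ cong (_+ o) (+-comm m n) ⟩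
  n + m + o    ≡⟨ +-assoc n m o ⟩
  n + (m + o)  ∎

<ᵇ-+ʳ : ∀ a b m → (a + m <ᵇ b + m) ≡ (a <ᵇ b)
<ᵇ-+ʳ a b m rewrite +-comm a m | +-comm b m = <ᵇ-+ˡ m
  where
  <ᵇ-+ˡ : ∀ m → (m + a <ᵇ m + b) ≡ (a <ᵇ b)
  <ᵇ-+ˡ zero    = refl
  <ᵇ-+ˡ (suc m) = <ᵇ-+ˡ m

≡ᵇ-+ʳ : ∀ a b m → (a + m ≡ᵇ b + m) ≡ (a ≡ᵇ b)
≡ᵇ-+ʳ a b m rewrite +-comm a m | +-comm b m = ≡ᵇ-+ˡ m
  where
  ≡ᵇ-+ˡ : ∀ m → (m + a ≡ᵇ m + b) ≡ (a ≡ᵇ b)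
  ≡ᵇ-+ˡ zero    = refl
  ≡ᵇ-+ˡ (suc m) = ≡ᵇ-+ˡ m

shift : ℕ → Str → Str
shift m = map (_+ m)

last-++ʳ : ∀ (xs : Str) {ys y} → last ys ≡ just y → last (xs ++ ys) ≡ just y
last-++ʳ []            h = h
last-++ʳ (x ∷ [])      {_ ∷ _} h = h
last-++ʳ (x ∷ x′ ∷ xs) h = last-++ʳ (x′ ∷ xs) h

Head : (ℕ → Set) → Str → Set
Head P []      = ⊥
Head P (a ∷ _) = P a

lexLeq-heads-< : ∀ {n} u v → Head (_< n) u → Head (n ≤_) v → lexLeq u v ≡ true
lexLeq-heads-< (a ∷ u) (b ∷ v) a<n n≤b with a <ᵇ b | <⇒<ᵇ (<-≤-trans a<n n≤b)
... | true | _ = refl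

lexLeq-heads-> : ∀ {n} u v → Head (n ≤_) u → Head (_< n) v → lexLeq u v ≡ false
lexLeq-heads-> (a ∷ u) (b ∷ v) n≤a b<n with a <ᵇ b | <ᵇ⇒< a b | a ≡ᵇ b | ≡ᵇ⇒≡ a b
... | true  | a<b | _     | _   = ⊥-elim (<-asym (a<b tt) (<-≤-trans b<n n≤a))
... | false | _   | true  | a≡b = ⊥-elim (<-irrefl (sym (a≡b tt)) (<-≤-trans b<n n≤a))
... | false | _   | false | _   = refl

diverge : Str → Str → Bool
diverge (a ∷ u) (b ∷ v) = if a ≡ᵇ b then diverge u v else true
diverge _       _       = false

Diverging : Str → Str → Set
Diverging u v = T (diverge u v)

lexLeq-shift-++ : ∀ m u v s t → Diverging u v →
                  lexLeq (shift m u ++ s) (shift m v ++ t) ≡ lexLeq u v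
lexLeq-shift-++ m (a ∷ u) (b ∷ v) s t d
  rewrite <ᵇ-+ʳ a b m | ≡ᵇ-+ʳ a b m with a <ᵇ b | a ≡ᵇ b
... | true  | _     = refl
... | false | true  = lexLeq-shift-++ m u v s t d
... | false | false = refl

module _ {A : Set} (key : A → Str) where

  insertOn : A → List A → List A
  insertOn x []       = x ∷ []
  insertOn x (y ∷ ys) = if lexLeq (key x) (key y) then x ∷ y ∷ ys else y ∷ insertOn x ys

  sortOn : List A → List A
  sortOn []       = []
  sortOn (x ∷ xs) = insertOn x (sortOn xs)

insert≡insertOn-id : ∀ x ys → insert x ys ≡ insertOn id x ys
insert≡insertOn-id x []       = refl
insert≡insertOn-id x (y ∷ ys) with lexLeq x y
... | true  = refl
... | false = cong (y ∷_) (insert≡insertOn-id x ys)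

sortStrs≡sortOn-id : ∀ xs → sortStrs xs ≡ sortOn id xs
sortStrs≡sortOn-id []       = refl
sortStrs≡sortOn-id (x ∷ xs) rewrite sortStrs≡sortOn-id xs = insert≡insertOn-id x (sortOn id xs)

module _ {A : Set} {key : A → Str} where

  All-insertOn : ∀ {P : A → Set} {x} ys → P x → All P ys → All P (insertOn key x ys)
  All-insertOn         []       px []         = px ∷ []
  All-insertOn {x = x} (y ∷ ys) px (py ∷ pys) with lexLeq (key x) (key y)
  ... | true  = px ∷ py ∷ pys
  ... | false = py ∷ All-insertOn ys px pys

  All-sortOn : ∀ {P : A → Set} {xs} → All P xs → All P (sortOn key xs)
  All-sortOn               []         = []
  All-sortOn {xs = x ∷ xs} (px ∷ pxs) = All-insertOn (sortOn key xs) px (All-sortOn pxs)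

  insertOn-++-≤ : ∀ x xs ys → All (λ y → lexLeq (key x) (key y) ≡ true) ys →
                  insertOn key x (xs ++ ys) ≡ insertOn key x xs ++ ys
  insertOn-++-≤ x []       []       _       = refl
  insertOn-++-≤ x []       (y ∷ ys) (p ∷ _) rewrite p = refl
  insertOn-++-≤ x (z ∷ xs) ys       ps with lexLeq (key x) (key z)
  ... | true  = refl
  ... | false = cong (z ∷_) (insertOn-++-≤ x xs ys ps)

  insertOn-++-≰ : ∀ x xs ys → All (λ z → lexLeq (key x) (key z) ≡ false) xs →
                  insertOn key x (xs ++ ys) ≡ xs ++ insertOn key x ys
  insertOn-++-≰ x []       ys _        = refl
  insertOn-++-≰ x (z ∷ xs) ys (p ∷ ps) rewrite p = cong (z ∷_) (insertOn-++-≰ x xs ys ps)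

  sortOn-++-≤ : ∀ xs ys → All (λ x → All (λ y → lexLeq (key x) (key y) ≡ true) ys) xs →
                sortOn key (xs ++ ys) ≡ sortOn key xs ++ sortOn key ys
  sortOn-++-≤ []       ys _        = refl
  sortOn-++-≤ (x ∷ xs) ys (p ∷ ps) = begin
    insertOn key x (sortOn key (xs ++ ys))
      ≡⟨ cong (insertOn key x) (sortOn-++-≤ xs ys ps) ⟩
    insertOn key x (sortOn key xs ++ sortOn key ys)
      ≡⟨ insertOn-++-≤ x (sortOn key xs) _ (All-sortOn p) ⟩
    insertOn key x (sortOn key xs) ++ sortOn key ys ∎

  sortOn-++-≰ : ∀ xs ys → All (λ x → All (λ y → lexLeq (key x) (key y) ≡ false) ys) xs →
                sortOn key (xs ++ ys) ≡ sortOn key ys ++ sortOn key xs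
  sortOn-++-≰ []       ys _        = sym (++-identityʳ _)
  sortOn-++-≰ (x ∷ xs) ys (p ∷ ps) = begin
    insertOn key x (sortOn key (xs ++ ys))
      ≡⟨ cong (insertOn key x) (sortOn-++-≰ xs ys ps) ⟩
    insertOn key x (sortOn key ys ++ sortOn key xs)
      ≡⟨ insertOn-++-≰ x (sortOn key ys) _ (All-sortOn p) ⟩
    sortOn key ys ++ insertOn key x (sortOn key xs) ∎

module _ {A B : Set} (k₁ : A → Str) (k₂ : B → Str) (f : A → B) where

  SameOrder : A → A → Set
  SameOrder x y = lexLeq (k₂ (f x)) (k₂ (f y)) ≡ lexLeq (k₁ x) (k₁ y)

  map-insertOn : ∀ x ys → All (SameOrder x) ys →
                 map f (insertOn k₁ x ys) ≡ insertOn k₂ (f x) (map f ys)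
  map-insertOn x []       []       = refl
  map-insertOn x (y ∷ ys) (p ∷ ps) rewrite p with lexLeq (k₁ x) (k₁ y)
  ... | true  = refl
  ... | false = cong (f y ∷_) (map-insertOn x ys ps)

  map-sortOn : ∀ xs → AllPairs SameOrder xs →
               map f (sortOn k₁ xs) ≡ sortOn k₂ (map f xs)
  map-sortOn []       []       = refl
  map-sortOn (x ∷ xs) (p ∷ ps) = begin
    map f (insertOn k₁ x (sortOn k₁ xs))         ≡⟨ map-insertOn x (sortOn k₁ xs) (All-sortOn p) ⟩
    insertOn k₂ (f x) (map f (sortOn k₁ xs))     ≡⟨ cong (insertOn k₂ (f x)) (map-sortOn xs ps) ⟩
    insertOn k₂ (f x) (sortOn k₂ (map f xs))     ∎

lastColumn : List Str → Str
lastColumn xs = mapMaybe last (sortOn id xs)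

lastColumn-++-below : ∀ {n} xs ys → All (Head (_< n)) xs → All (Head (n ≤_)) ys →
                      lastColumn (xs ++ ys) ≡ lastColumn xs ++ lastColumn ys
lastColumn-++-below xs ys hxs hys = begin
  mapMaybe last (sortOn id (xs ++ ys))          ≡⟨ cong (mapMaybe last) (sortOn-++-≤ xs ys ordered) ⟩
  mapMaybe last (sortOn id xs ++ sortOn id ys)  ≡⟨ mapMaybe-++ last (sortOn id xs) _ ⟩
  lastColumn xs ++ lastColumn ys                ∎
  where ordered = All.map (λ {x} hx → All.map (λ {y} → lexLeq-heads-< x y hx) hys) hxs

lastColumn-++-above : ∀ {n} xs ys → All (Head (n ≤_)) xs → All (Head (_< n)) ys →
                      lastColumn (xs ++ ys) ≡ lastColumn ys ++ lastColumn xs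
lastColumn-++-above xs ys hxs hys = begin
  mapMaybe last (sortOn id (xs ++ ys))          ≡⟨ cong (mapMaybe last) (sortOn-++-≰ xs ys ordered) ⟩
  mapMaybe last (sortOn id ys ++ sortOn id xs)  ≡⟨ mapMaybe-++ last (sortOn id ys) _ ⟩
  lastColumn ys ++ lastColumn xs                ∎
  where ordered = All.map (λ {x} hx → All.map (λ {y} → lexLeq-heads-> x y hx) hys) hxs

-- The rotations of w ++ pre that start inside w.
rotationsFrom : Str → Str → List Str
rotationsFrom pre []      = []
rotationsFrom pre (a ∷ w) = ((a ∷ w) ++ pre) ∷ rotationsFrom (pre ++ a ∷ []) w

applyUpTo-rotationsFrom : ∀ pre w {f : ℕ → Str} → (∀ i → f i ≡ drop i w ++ pre ++ take i w) →
                          applyUpTo f (length w) ≡ rotationsFrom pre w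
applyUpTo-rotationsFrom pre []      _ = refl
applyUpTo-rotationsFrom pre (a ∷ w) f≗ = cong₂ _∷_
  (trans (f≗ 0) (cong ((a ∷ w) ++_) (++-identityʳ pre)))
  (applyUpTo-rotationsFrom (pre ++ a ∷ []) w λ i →
    trans (f≗ (suc i)) (cong (drop i w ++_) (sym (++-assoc pre (a ∷ []) (take i w)))))

BWT≡lastColumn : ∀ w → BWT w ≡ lastColumn (rotationsFrom [] w)
BWT≡lastColumn w = cong (mapMaybe last) (begin
  sortStrs (rotations w)               ≡⟨ sortStrs≡sortOn-id (rotations w) ⟩
  sortOn id (rotations w)              ≡⟨ cong (sortOn id) (map-applyUpTo id (rotation w) (length w)) ⟩
  sortOn id (applyUpTo (rotation w) (length w))
    ≡⟨ cong (sortOn id) (applyUpTo-rotationsFrom [] w (λ _ → refl)) ⟩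
  sortOn id (rotationsFrom [] w)       ∎)

All-Head-rotationsFrom : ∀ {P : ℕ → Set} pre w → All P w → All (Head P) (rotationsFrom pre w)
All-Head-rotationsFrom pre []      []       = []
All-Head-rotationsFrom pre (a ∷ w) (p ∷ ps) = p ∷ All-Head-rotationsFrom (pre ++ a ∷ []) w ps

-- (u , t) stands for the string shift o u ++ t, whose rank among the rotations is decided by u.
Keyed : Set
Keyed = Str × Str

keyed : ℕ → Keyed → Str
keyed o x = shift o (proj₁ x) ++ proj₂ x

suffixes : Str → List Str
suffixes []      = []
suffixes (a ∷ u) = (a ∷ u) ∷ suffixes u

blockRotations : ℕ → Str → Str → Str → List Keyed
blockRotations o pre rest []      = []
blockRotations o pre rest (a ∷ u) =
  (a ∷ u , rest ++ pre) ∷ blockRotations o (pre ++ a + o ∷ []) rest u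

-- Each suffix of the block paired with the letter cyclically preceding it, i.e. the last letter
-- of the rotation starting with that suffix; c precedes the whole block.
suffixPredecessors : ℕ → ℕ → Str → List (Str × Maybe ℕ)
suffixPredecessors c o []      = []
suffixPredecessors c o (a ∷ u) = (a ∷ u , just c) ∷ suffixPredecessors (a + o) o u

blockColumn : ℕ → ℕ → Str → Str
blockColumn c o b = mapMaybe proj₂ (sortOn proj₁ (suffixPredecessors c o b))

rotationsFrom-shift-++ : ∀ o b pre rest →
  rotationsFrom pre (shift o b ++ rest)
    ≡ map (keyed o) (blockRotations o pre rest b) ++ rotationsFrom (pre ++ shift o b) rest
rotationsFrom-shift-++ o []      pre rest = cong (λ p → rotationsFrom p rest) (sym (++-identityʳ pre))
rotationsFrom-shift-++ o (a ∷ u) pre rest = cong₂ _∷_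
  (cong (a + o ∷_) (++-assoc (shift o u) rest pre))
  (trans (rotationsFrom-shift-++ o u (pre ++ a + o ∷ []) rest)
         (cong (map (keyed o) (blockRotations o (pre ++ a + o ∷ []) rest u) ++_)
               (cong (λ p → rotationsFrom p rest) (++-assoc pre (a + o ∷ []) (shift o u)))))

map-proj₁-blockRotations : ∀ o pre rest b → map proj₁ (blockRotations o pre rest b) ≡ suffixes b
map-proj₁-blockRotations o pre rest []      = refl
map-proj₁-blockRotations o pre rest (a ∷ u) =
  cong ((a ∷ u) ∷_) (map-proj₁-blockRotations o _ rest u)

All-Head-blockRotations : ∀ {P : ℕ → Set} o pre rest b → All P (shift o b) →
                          All (Head P) (map (keyed o) (blockRotations o pre rest b))
All-Head-blockRotations o pre rest []      []       = []
All-Head-blockRotations o pre rest (a ∷ u) (p ∷ ps) = p ∷ All-Head-blockRotations o _ rest u ps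

withLast : ℕ → Keyed → Str × Maybe ℕ
withLast o x = proj₁ x , last (keyed o x)

map-withLast-blockRotations : ∀ o b pre rest {c} → last (shift o b ++ rest ++ pre) ≡ just c →
  map (withLast o) (blockRotations o pre rest b) ≡ suffixPredecessors c o b
map-withLast-blockRotations o []      pre rest h = refl
map-withLast-blockRotations o (a ∷ u) pre rest h = cong₂ _∷_ (cong (a ∷ u ,_) h)
  (map-withLast-blockRotations o u (pre ++ a + o ∷ []) rest
    (last-++ʳ (shift o u) (last-++ʳ rest (last-++ʳ pre refl))))

lastColumn-blockRotations : ∀ o b pre rest {c} → AllPairs Diverging (suffixes b) →
  last (shift o b ++ rest ++ pre) ≡ just c →
  lastColumn (map (keyed o) (blockRotations o pre rest b)) ≡ blockColumn c o b
lastColumn-blockRotations o b pre rest div h = begin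
  mapMaybe last (sortOn id (map (keyed o) B))
    ≡⟨ cong (mapMaybe last) (sym (map-sortOn proj₁ id (keyed o) B
         (AllPairs.map (λ {x} {y} → lexLeq-shift-++ o (proj₁ x) (proj₁ y) (proj₂ x) (proj₂ y))
                       divB))) ⟩
  mapMaybe last (map (keyed o) (sortOn proj₁ B))
    ≡⟨ trans (mapMaybe-map last (keyed o) (sortOn proj₁ B))
             (sym (mapMaybe-map proj₂ (withLast o) (sortOn proj₁ B))) ⟩
  mapMaybe proj₂ (map (withLast o) (sortOn proj₁ B))
    ≡⟨ cong (mapMaybe proj₂) (map-sortOn proj₁ proj₁ (withLast o) B (AllPairs.map (λ _ → refl) divB)) ⟩
  mapMaybe proj₂ (sortOn proj₁ (map (withLast o) B))
    ≡⟨ cong (mapMaybe proj₂ ∘ sortOn proj₁) (map-withLast-blockRotations o b pre rest h) ⟩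
  blockColumn _ o b ∎
  where
  B = blockRotations o pre rest b
  divB : AllPairs (λ x y → Diverging (proj₁ x) (proj₁ y)) B
  divB = AllPairsₚ.map⁻ (subst (AllPairs Diverging) (sym (map-proj₁-blockRotations o pre rest b)) div)

lastColumn-rotationsFrom-below : ∀ {n c} o b pre rest → AllPairs Diverging (suffixes b) →
  All (_< n) (shift o b) → All (n ≤_) rest → last (shift o b ++ rest ++ pre) ≡ just c →
  lastColumn (rotationsFrom pre (shift o b ++ rest))
    ≡ blockColumn c o b ++ lastColumn (rotationsFrom (pre ++ shift o b) rest)
lastColumn-rotationsFrom-below o b pre rest div b<n n≤rest h = begin
  lastColumn (rotationsFrom pre (shift o b ++ rest))
    ≡⟨ cong lastColumn (rotationsFrom-shift-++ o b pre rest) ⟩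
  lastColumn (map (keyed o) (blockRotations o pre rest b) ++ rotationsFrom (pre ++ shift o b) rest)
    ≡⟨ lastColumn-++-below _ _ (All-Head-blockRotations o pre rest b b<n)
                               (All-Head-rotationsFrom _ rest n≤rest) ⟩
  lastColumn (map (keyed o) (blockRotations o pre rest b)) ++ lastColumn (rotationsFrom (pre ++ shift o b) rest)
    ≡⟨ cong (_++ _) (lastColumn-blockRotations o b pre rest div h) ⟩
  blockColumn _ o b ++ lastColumn (rotationsFrom (pre ++ shift o b) rest) ∎

lastColumn-rotationsFrom-above : ∀ {n c} o b pre rest → AllPairs Diverging (suffixes b) →
  All (n ≤_) (shift o b) → All (_< n) rest → last (shift o b ++ rest ++ pre) ≡ just c →
  lastColumn (rotationsFrom pre (shift o b ++ rest))
    ≡ lastColumn (rotationsFrom (pre ++ shift o b) rest) ++ blockColumn c o b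
lastColumn-rotationsFrom-above o b pre rest div n≤b rest<n h = begin
  lastColumn (rotationsFrom pre (shift o b ++ rest))
    ≡⟨ cong lastColumn (rotationsFrom-shift-++ o b pre rest) ⟩
  lastColumn (map (keyed o) (blockRotations o pre rest b) ++ rotationsFrom (pre ++ shift o b) rest)
    ≡⟨ lastColumn-++-above _ _ (All-Head-blockRotations o pre rest b n≤b)
                               (All-Head-rotationsFrom _ rest rest<n) ⟩
  lastColumn (rotationsFrom (pre ++ shift o b) rest) ++ lastColumn (map (keyed o) (blockRotations o pre rest b))
    ≡⟨ cong (_ ++_) (lastColumn-blockRotations o b pre rest div h) ⟩
  lastColumn (rotationsFrom (pre ++ shift o b) rest) ++ blockColumn _ o b ∎

All-shift-< : ∀ {n} m u → All (_< n) u → All (_< n + m) (shift m u)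
All-shift-< m u = Allₚ.map⁺ ∘ All.map (+-monoˡ-< m)

All-shift-≥ : ∀ m u → All (m ≤_) (shift m u)
All-shift-≥ m u = Allₚ.map⁺ (All.universal (m≤n+m m) u)

block : Str
block = 0 ∷ 2 ∷ 2 ∷ 2 ∷ 1 ∷ []

block-<3 : All (_< 3) block
block-<3 = from-yes (all? (_<? 3) block)

reverse-block-<3 : All (_< 3) (reverse block)
reverse-block-<3 = from-yes (all? (_<? 3) (reverse block))

suffixes-block-diverging : AllPairs Diverging (suffixes block)
suffixes-block-diverging = from-yes (allPairs? (λ u v → T? (diverge u v)) (suffixes block))

suffixes-reverse-block-diverging : AllPairs Diverging (suffixes (reverse block))
suffixes-reverse-block-diverging =
  from-yes (allPairs? (λ u v → T? (diverge u v)) (suffixes (reverse block)))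

stairs : ℕ → ℕ → Str
stairs m zero    = []
stairs m (suc k) = shift m block ++ stairs (3 + m) k

stairsᴿ : ℕ → ℕ → Str
stairsᴿ m zero    = []
stairsᴿ m (suc k) = shift (k * 3 + m) (reverse block) ++ stairsᴿ m k

stairs-≥ : ∀ k m → All (m ≤_) (stairs m k)
stairs-≥ zero    m = []
stairs-≥ (suc k) m =
  Allₚ.++⁺ (All-shift-≥ m block) (All.map (≤-trans (m≤n+m m 3)) (stairs-≥ k (3 + m)))

stairsᴿ-< : ∀ k m → All (_< k * 3 + m) (stairsᴿ m k)
stairsᴿ-< zero    m = []
stairsᴿ-< (suc k) m = Allₚ.++⁺ (All-shift-< (k * 3 + m) (reverse block) reverse-block-<3)
                              (All.map (λ p → <-≤-trans p (m≤n+m _ 3)) (stairsᴿ-< k m))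

stairsᴿ-∷ʳ : ∀ k m → stairsᴿ (3 + m) k ++ shift m (reverse block) ≡ stairsᴿ m (suc k)
stairsᴿ-∷ʳ zero    m = sym (++-identityʳ _)
stairsᴿ-∷ʳ (suc k) m = trans
  (++-assoc (shift (k * 3 + (3 + m)) (reverse block)) (stairsᴿ (3 + m) k) (shift m (reverse block)))
  (cong₂ _++_ (cong (λ o → shift o (reverse block)) (m+[n+o]≡n+[m+o] (k * 3) 3 m))
              (stairsᴿ-∷ʳ k m))

reverse-stairs : ∀ k m → reverse (stairs m k) ≡ stairsᴿ m k
reverse-stairs zero    m = refl
reverse-stairs (suc k) m = begin
  reverse (shift m block ++ stairs (3 + m) k)
    ≡⟨ reverse-++ (shift m block) (stairs (3 + m) k) ⟩
  reverse (stairs (3 + m) k) ++ shift m (reverse block)   ≡⟨ cong (_++ _) (reverse-stairs k (3 + m)) ⟩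
  stairsᴿ (3 + m) k ++ shift m (reverse block)            ≡⟨ stairsᴿ-∷ʳ k m ⟩
  stairsᴿ m (suc k)                                       ∎

length-stairs : ∀ k m → length (stairs m k) ≡ k * 5
length-stairs zero    m = refl
length-stairs (suc k) m = cong (5 +_) (length-stairs k (3 + m))

last-stairs : ∀ k m → last (stairs m (suc k)) ≡ just (1 + (k * 3 + m))
last-stairs zero    m = refl
last-stairs (suc k) m = trans (last-++ʳ (shift m block) {stairs (3 + m) (suc k)} (last-stairs k (3 + m)))
                              (cong (just ∘ suc) (m+[n+o]≡n+[m+o] (k * 3) 3 m))

last-stairsᴿ : ∀ k m → last (stairsᴿ m (suc k)) ≡ just m
last-stairsᴿ zero    m = refl
last-stairsᴿ (suc k) m =
  last-++ʳ (shift (suc k * 3 + m) (reverse block)) {stairsᴿ m (suc k)} (last-stairsᴿ k m)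

bwtStairs : ℕ → ℕ → ℕ → Str
bwtStairs m zero    c = []
bwtStairs m (suc k) c = c ∷ shift m (2 ∷ 2 ∷ 2 ∷ 0 ∷ []) ++ bwtStairs (3 + m) k (1 + m)

bwtBlockᴿ : ℕ → ℕ → Str
bwtBlockᴿ o c = 2 + o ∷ c ∷ shift o (2 ∷ 2 ∷ 1 ∷ [])

bwtStairsᴿ : ℕ → ℕ → ℕ → Str
bwtStairsᴿ m zero    c = []
bwtStairsᴿ m (suc k) c = bwtStairsᴿ m k (k * 3 + m) ++ bwtBlockᴿ (k * 3 + m) c

lastColumn-stairs : ∀ k m pre {c} → last (stairs m k ++ pre) ≡ just c →
                    lastColumn (rotationsFrom pre (stairs m k)) ≡ bwtStairs m k c
lastColumn-stairs zero    m pre h = refl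
lastColumn-stairs (suc k) m pre {c} h = begin
  lastColumn (rotationsFrom pre (shift m block ++ rest))
    ≡⟨ lastColumn-rotationsFrom-below m block pre rest suffixes-block-diverging
         (All-shift-< m block block-<3) (stairs-≥ k (3 + m)) h ⟩
  c ∷ shift m (2 ∷ 2 ∷ 2 ∷ 0 ∷ []) ++ lastColumn (rotationsFrom (pre ++ shift m block) rest)
    ≡⟨ cong (c ∷_) (cong (shift m (2 ∷ 2 ∷ 2 ∷ 0 ∷ []) ++_)
         (lastColumn-stairs k (3 + m) _ (last-++ʳ rest (last-++ʳ pre refl)))) ⟩
  bwtStairs m (suc k) c ∎
  where rest = stairs (3 + m) k

lastColumn-stairsᴿ : ∀ k m pre {c} → last (stairsᴿ m k ++ pre) ≡ just c →
                     lastColumn (rotationsFrom pre (stairsᴿ m k)) ≡ bwtStairsᴿ m k c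
lastColumn-stairsᴿ zero    m pre h = refl
lastColumn-stairsᴿ (suc k) m pre {c} h = begin
  lastColumn (rotationsFrom pre (shift o (reverse block) ++ rest))
    ≡⟨ lastColumn-rotationsFrom-above o (reverse block) pre rest suffixes-reverse-block-diverging
         (All-shift-≥ o (reverse block)) (stairsᴿ-< k m) h ⟩
  lastColumn (rotationsFrom (pre ++ shift o (reverse block)) rest) ++ bwtBlockᴿ o c
    ≡⟨ cong (_++ bwtBlockᴿ o c) (lastColumn-stairsᴿ k m _ (last-++ʳ rest (last-++ʳ pre refl))) ⟩
  bwtStairsᴿ m (suc k) c ∎
  where
  o = k * 3 + m
  rest = stairsᴿ m k

lastOr : ℕ → Str → ℕ
lastOr a []       = a
lastOr a (b ∷ bs) = lastOr b bs

lastOr-++ : ∀ a xs ys → lastOr a (xs ++ ys) ≡ lastOr (lastOr a xs) ys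
lastOr-++ a []       ys = refl
lastOr-++ a (b ∷ xs) ys = lastOr-++ b xs ys

runsFrom-++ : ∀ a xs ys → runsFrom a (xs ++ ys) ≡ runsFrom a xs + runsFrom (lastOr a xs) ys
runsFrom-++ a []       ys = refl
runsFrom-++ a (b ∷ xs) ys rewrite runsFrom-++ b xs ys = sym (+-assoc (if a ≡ᵇ b then 0 else 1) _ _)

runs-++ : ∀ xs ys → xs ≢ [] → runs (xs ++ ys) ≡ runs xs + runsFrom (lastOr 0 xs) ys
runs-++ []       ys xs≢[] = ⊥-elim (xs≢[] refl)
runs-++ (a ∷ xs) ys _     = cong suc (runsFrom-++ a xs ys)

runsFrom-≢ : ∀ {a} b s → a ≢ b → runsFrom a (b ∷ s) ≡ suc (runsFrom b s)
runsFrom-≢ {a} b s a≢b with a ≡ᵇ b | ≡ᵇ⇒≡ a b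
... | true  | a≡b = ⊥-elim (a≢b (a≡b tt))
... | false | _   = refl

runsFrom-shift : ∀ a m s → runsFrom (a + m) (shift m s) ≡ runsFrom a s
runsFrom-shift a m []      = refl
runsFrom-shift a m (b ∷ s) rewrite ≡ᵇ-+ʳ a b m | runsFrom-shift b m s = refl

runsFrom-bwtStairs : ∀ k m → runsFrom m (bwtStairs (3 + m) k (1 + m)) ≡ k * 3
runsFrom-bwtStairs zero    m = refl
runsFrom-bwtStairs (suc k) m = begin
  runsFrom m (shift m first ++ rest)                  ≡⟨ runsFrom-++ m (shift m first) rest ⟩
  runsFrom m (shift m first) + runsFrom (3 + m) rest
    ≡⟨ cong₂ _+_ (runsFrom-shift 0 m first) (runsFrom-bwtStairs k (3 + m)) ⟩
  3 + k * 3                                           ∎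
  where
  first = 1 ∷ 5 ∷ 5 ∷ 5 ∷ 3 ∷ []
  rest = bwtStairs (6 + m) k (4 + m)

-- Splitting on k lets the comparison of the first block's predecessor 3k + 1 with 2 evaluate.
runs-bwtStairs : ∀ k → runs (bwtStairs 0 (suc k) (1 + (k * 3 + 0))) ≡ suc k * 3
runs-bwtStairs zero    = refl
runs-bwtStairs (suc k) = cong (3 +_) (runsFrom-bwtStairs (suc k) 0)

runsFrom-bwtBlockᴿ : ∀ {a c} o → a ≢ 2 + o → c ≢ 2 + o → runsFrom a (bwtBlockᴿ o c) ≡ 4
runsFrom-bwtBlockᴿ {a} {c} o a≢ c≢ = begin
  runsFrom a (2 + o ∷ c ∷ 2 + o ∷ rest)    ≡⟨ runsFrom-≢ (2 + o) (c ∷ 2 + o ∷ rest) a≢ ⟩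
  1 + runsFrom (2 + o) (c ∷ 2 + o ∷ rest)  ≡⟨ cong suc (runsFrom-≢ c (2 + o ∷ rest) (≢-sym c≢)) ⟩
  2 + runsFrom c (2 + o ∷ rest)            ≡⟨ cong (2 +_) (runsFrom-≢ (2 + o) rest c≢) ⟩
  3 + runsFrom (2 + o) rest                ≡⟨ cong (3 +_) (runsFrom-shift 2 o (2 ∷ 1 ∷ [])) ⟩
  4                                        ∎
  where rest = shift o (2 ∷ 1 ∷ [])

runs-bwtStairsᴿ : ∀ k m {c} → c ≢ 2 + (k * 3 + m) → runs (bwtStairsᴿ m (suc k) c) ≡ suc k * 4
runs-bwtStairsᴿ zero    m {c} c≢ =
  trans (sym (runsFrom-≢ (2 + m) (c ∷ shift m (2 ∷ 2 ∷ 1 ∷ [])) (m≢1+n+m m)))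
        (runsFrom-bwtBlockᴿ m (m≢1+n+m m) c≢)
runs-bwtStairsᴿ (suc k) m {c} c≢ = begin
  runs (front ++ bwtBlockᴿ o c)
    ≡⟨ runs-++ front _ ((λ ()) ∘ ++-conicalʳ (bwtStairsᴿ m k (k * 3 + m)) (bwtBlockᴿ x o)) ⟩
  runs front + runsFrom (lastOr 0 front) (bwtBlockᴿ o c)
    ≡⟨ cong₂ _+_ (runs-bwtStairsᴿ k m (≢-sym (m≢1+n+m (2 + x) {0})))
                 (cong (λ a → runsFrom a (bwtBlockᴿ o c))
                       (lastOr-++ 0 (bwtStairsᴿ m k (k * 3 + m)) (bwtBlockᴿ x o))) ⟩
  suc k * 4 + runsFrom (1 + x) (bwtBlockᴿ o c)
    ≡⟨ cong (suc k * 4 +_) (runsFrom-bwtBlockᴿ o (m≢1+n+m (1 + x) {3}) c≢) ⟩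
  suc k * 4 + 4
    ≡⟨ +-comm (suc k * 4) 4 ⟩
  suc (suc k) * 4 ∎
  where
  x = k * 3 + m
  o = suc k * 3 + m
  front = bwtStairsᴿ m (suc k) o

r-stairs : ∀ k → r (stairs 0 (suc k)) ≡ suc k * 3
r-stairs k = begin
  runs (BWT w)                                  ≡⟨ cong runs (BWT≡lastColumn w) ⟩
  runs (lastColumn (rotationsFrom [] w))
    ≡⟨ cong runs (lastColumn-stairs (suc k) 0 []
                   (trans (cong last (++-identityʳ w)) (last-stairs k 0))) ⟩
  runs (bwtStairs 0 (suc k) (1 + (k * 3 + 0)))  ≡⟨ runs-bwtStairs k ⟩
  suc k * 3                                     ∎
  where w = stairs 0 (suc k)

r-reverse-stairs : ∀ k → r (reverse (stairs 0 (suc k))) ≡ suc k * 4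
r-reverse-stairs k = begin
  runs (BWT (reverse (stairs 0 (suc k))))  ≡⟨ cong (runs ∘ BWT) (reverse-stairs (suc k) 0) ⟩
  runs (BWT u)                             ≡⟨ cong runs (BWT≡lastColumn u) ⟩
  runs (lastColumn (rotationsFrom [] u))
    ≡⟨ cong runs (lastColumn-stairsᴿ (suc k) 0 []
                   (trans (cong last (++-identityʳ u)) (last-stairsᴿ k 0))) ⟩
  runs (bwtStairsᴿ 0 (suc k) 0)            ≡⟨ runs-bwtStairsᴿ k 0 (λ ()) ⟩
  suc k * 4                                ∎
  where u = stairsᴿ 0 (suc k)

proposition3p4 : (N : ℕ) → Σ Str (λ w → (length w ≥ N) × (5 * r (reverse w) ≡ 5 * r w + length w))
proposition3p4 N = w , length-≥ , runs-gap
  where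
  w = stairs 0 (suc N)

  length-≥ : length w ≥ N
  length-≥ = subst (_≥ N) (sym (length-stairs (suc N) 0)) (≤-trans (n≤1+n N) (m≤m*n (suc N) 5))

  arith : ∀ k → 5 * (k * 4) ≡ 5 * (k * 3) + k * 5
  arith = solve-∀

  runs-gap : 5 * r (reverse w) ≡ 5 * r w + length w
  runs-gap = begin
    5 * r (reverse w)           ≡⟨ cong (5 *_) (r-reverse-stairs N) ⟩
    5 * (suc N * 4)             ≡⟨ arith (suc N) ⟩
    5 * (suc N * 3) + suc N * 5
      ≡⟨ sym (cong₂ (λ a b → 5 * a + b) (r-stairs N) (length-stairs (suc N) 0)) ⟩
    5 * r w + length w          ∎
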